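{- In the Hilbert calculus $IvFDE_T$, for every formula $\varphi$ (where "equivalent" means each formula derives the other): (1) $\theta_{T_0}(\varphi):=\square\varphi$ is equivalent to $\varphi\land\square\varphi\land\sim\square\sim\varphi\land\sim\neg\varphi$; (2) $\theta_{t_1}(\varphi):=\varphi\land\neg\varphi$ is equivalent to $\varphi\land\sim\square\varphi\land\sim\square\sim\varphi\land\neg\varphi$; (3) $\theta_{t_0}(\varphi):=\varphi\land\sim\neg\varphi\land\sim\square\varphi$ is equivalent to $\varphi\land\sim\square\varphi\land\sim\square\sim\varphi\land\sim\neg\varphi$; (4) $\theta_{f_1}(\varphi):=\sim\varphi\land\neg\varphi\land\sim\square\sim\varphi$ is equivalent to $\sim\varphi\land\sim\square\varphi\land\sim\square\sim\varphi\land\neg\varphi$; (5) $\theta_{f_0}(\varphi):=\sim\varphi\land\sim\neg\varphi$ is equivalent to $\sim\varphi\land\sim\square\varphi\land\sim\square\sim\varphi\land\sim\neg\varphi$; (6) $\theta_{F_1}(\varphi):=\square\sim\varphi$ is equivalent to $\sim\varphi\land\sim\square\varphi\land\square\sim\varphi\land\neg\varphi$.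
   Context: Formulas are built from a countable set of propositional variables using binary $\land,\lor,\to$ and unary $\neg,\sim,\square$. Write $\alpha\leftrightarrow\beta$ for $(\alpha\to\beta)\land(\beta\to\alpha)$. $IvFDE_T$ is the Hilbert calculus with modus ponens as the only rule and the following axiom schemas: - $\varphi\to(\psi\to\varphi)$; - $(\varphi\to(\psi\to\gamma))\to((\varphi\to\psi)\to(\varphi\to\gamma))$; - $\varphi\to(\psi\to(\varphi\land\psi))$; - $(\varphi\land\psi)\to\varphi$; - $(\varphi\land\psi)\to\psi$; - $\varphi\to(\varphi\lor\psi)$; - $\psi\to(\varphi\lor\psi)$; - $(\varphi\to\gamma)\to((\psi\to\gamma)\to((\varphi\lor\psi)\to\gamma))$; - $\neg\neg\varphi\leftrightarrow\varphi$; - $\neg(\varphi\lor\psi)\leftrightarrow(\neg\varphi\land\neg\psi)$; - $\neg(\varphi\land\psi)\leftrightarrow(\neg\varphi\lor\neg\psi)$; - $\neg(\varphi\to\psi)\leftrightarrow(\varphi\land\neg\psi)$; - $\varphi\lor(\varphi\to\psi)$; - $(\sim\psi\to\sim\varphi)\to((\sim\psi\to\varphi)\to\psi)$; - $\square(\varphi\to\psi)\to(\square\varphi\to\square\psi)$; - $\square(\varphi\to\psi)\to(\square\sim\psi\to\square\sim\varphi)$; - $\square\sim(\varphi\to\psi)\leftrightarrow(\square\varphi\land\square\sim\psi)$; - $(\square\sim\varphi\lor\square\psi)\to\square(\varphi\to\psi)$; - $\square\varphi\to\varphi$; - $\square\varphi\leftrightarrow\square\sim\sim\varphi$; - $\square(\varphi\land\psi)\leftrightarrow(\square\varphi\land\square\psi)$;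 - $\square\sim(\varphi\lor\psi)\leftrightarrow\square(\sim\varphi\land\sim\psi)$; - $(\square\sim\varphi\lor\square\sim\psi)\to\square\sim(\varphi\land\psi)$; - $(\square\varphi\lor\square\psi)\to\square(\varphi\lor\psi)$; - $\square\varphi\leftrightarrow\square\sim\neg\varphi$; - $\square\sim\varphi\leftrightarrow\square\sim\neg\neg\varphi$; - $\square\sim(\varphi\land\psi)\to(\square\varphi\to\square\sim\psi)$; - $\square\sim(\varphi\land\psi)\to(\square\psi\to\square\sim\varphi)$; - $\square(\varphi\lor\psi)\to(\square\sim\varphi\to\square\psi)$; - $\square(\varphi\lor\psi)\to(\square\sim\psi\to\square\varphi)$. -}

module Defs where

open import Data.Nat using (ℕ)
open import Data.Product using (_×_)
open import Relation.Binary.PropositionalEquality using (_≡_)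

data Form : Set where
  var  : ℕ → Form
  _∧_  : Form → Form → Form
  _∨_  : Form → Form → Form
  _⇒_  : Form → Form → Form
  ¬'_  : Form → Form   -- ¬ (paraconsistent negation)
  ∼_   : Form → Form   -- ∼ (strong / classical negation)
  □_   : Form → Form

infixr 4 _⇒_
infixr 5 _∨_
infixr 6 _∧_
infix 8 ¬'_ ∼_ □_

_⇔_ : Form → Form → Form
α ⇔ β = (α ⇒ β) ∧ (β ⇒ α)
infix 3 _⇔_

data Axiom : Form → Set where
  K    : ∀ φ ψ → Axiom (φ ⇒ (ψ ⇒ φ))
  S    : ∀ φ ψ γ → Axiom ((φ ⇒ (ψ ⇒ γ)) ⇒ ((φ ⇒ ψ) ⇒ (φ ⇒ γ)))
  ∧I   : ∀ φ ψ → Axiom (φ ⇒ (ψ ⇒ (φ ∧ ψ)))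
  ∧E₁  : ∀ φ ψ → Axiom ((φ ∧ ψ) ⇒ φ)
  ∧E₂  : ∀ φ ψ → Axiom ((φ ∧ ψ) ⇒ ψ)
  ∨I₁  : ∀ φ ψ → Axiom (φ ⇒ (φ ∨ ψ))
  ∨I₂  : ∀ φ ψ → Axiom (ψ ⇒ (φ ∨ ψ))
  ∨E   : ∀ φ ψ γ → Axiom ((φ ⇒ γ) ⇒ ((ψ ⇒ γ) ⇒ ((φ ∨ ψ) ⇒ γ)))
  ¬¬   : ∀ φ → Axiom (¬' ¬' φ ⇔ φ)
  ¬∨   : ∀ φ ψ → Axiom (¬' (φ ∨ ψ) ⇔ (¬' φ ∧ ¬' ψ))
  ¬∧   : ∀ φ ψ → Axiom (¬' (φ ∧ ψ) ⇔ (¬' φ ∨ ¬' ψ))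
  ¬⇒   : ∀ φ ψ → Axiom (¬' (φ ⇒ ψ) ⇔ (φ ∧ ¬' ψ))
  Peirce : ∀ φ ψ → Axiom (φ ∨ (φ ⇒ ψ))
  ∼ax  : ∀ φ ψ → Axiom ((∼ ψ ⇒ ∼ φ) ⇒ ((∼ ψ ⇒ φ) ⇒ ψ))
  □K   : ∀ φ ψ → Axiom (□ (φ ⇒ ψ) ⇒ (□ φ ⇒ □ ψ))
  □K∼  : ∀ φ ψ → Axiom (□ (φ ⇒ ψ) ⇒ (□ ∼ ψ ⇒ □ ∼ φ))
  □∼⇒  : ∀ φ ψ → Axiom (□ ∼ (φ ⇒ ψ) ⇔ (□ φ ∧ □ ∼ ψ))
  □⇒I  : ∀ φ ψ → Axiom ((□ ∼ φ ∨ □ ψ) ⇒ □ (φ ⇒ ψ))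
  T    : ∀ φ → Axiom (□ φ ⇒ φ)
  □∼∼  : ∀ φ → Axiom (□ φ ⇔ □ ∼ ∼ φ)
  □∧   : ∀ φ ψ → Axiom (□ (φ ∧ ψ) ⇔ (□ φ ∧ □ ψ))
  □∼∨  : ∀ φ ψ → Axiom (□ ∼ (φ ∨ ψ) ⇔ □ (∼ φ ∧ ∼ ψ))
  □∼∧I : ∀ φ ψ → Axiom ((□ ∼ φ ∨ □ ∼ ψ) ⇒ □ ∼ (φ ∧ ψ))
  □∨I  : ∀ φ ψ → Axiom ((□ φ ∨ □ ψ) ⇒ □ (φ ∨ ψ))
  □∼¬  : ∀ φ → Axiom (□ φ ⇔ □ ∼ ¬' φ)
  □∼¬¬ : ∀ φ → Axiom (□ ∼ φ ⇔ □ ∼ ¬' ¬' φ)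
  □∼∧₁ : ∀ φ ψ → Axiom (□ ∼ (φ ∧ ψ) ⇒ (□ φ ⇒ □ ∼ ψ))
  □∼∧₂ : ∀ φ ψ → Axiom (□ ∼ (φ ∧ ψ) ⇒ (□ ψ ⇒ □ ∼ φ))
  □∨₁  : ∀ φ ψ → Axiom (□ (φ ∨ ψ) ⇒ (□ ∼ φ ⇒ □ ψ))
  □∨₂  : ∀ φ ψ → Axiom (□ (φ ∨ ψ) ⇒ (□ ∼ ψ ⇒ □ φ))

data _⊢_ (Γ : Form → Set) : Form → Set where
  hyp : ∀ {φ} → Γ φ → Γ ⊢ φ
  ax  : ∀ {φ} → Axiom φ → Γ ⊢ φ
  mp  : ∀ {φ ψ} → Γ ⊢ (φ ⇒ ψ) → Γ ⊢ φ → Γ ⊢ ψ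

infix 2 _⊢_

⟨_⟩ : Form → Form → Set
⟨ φ ⟩ ψ = ψ ≡ φ

_≣_ : Form → Form → Set
φ ≣ ψ = (⟨ φ ⟩ ⊢ ψ) × (⟨ ψ ⟩ ⊢ φ)

infix 1 _≣_

-- Every conjunct of each right-hand side is either a conjunct of the left-hand
-- side or follows from one using axiom T, the axioms □φ ⇔ □∼¬'φ and
-- □∼φ ⇔ □∼¬'¬'φ, and reductio for the strong negation ∼; the converse
-- directions are projections.
module Submission where

open import Defs
open import Data.Product using (_×_; _,_)
open import Data.Sum using (_⊎_; inj₁; inj₂)
open import Relation.Binary.PropositionalEquality using (_≡_; refl)

_▸_ : (Form → Set) → Form → Form → Set
(Γ ▸ φ) ψ = Γ ψ ⊎ ψ ≡ φ

infixl 3 _▸_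

module _ {Γ : Form → Set} where

  ⊢-id : ∀ {φ} → Γ ⊢ φ ⇒ φ
  ⊢-id {φ} = mp (mp (ax (S φ (φ ⇒ φ) φ)) (ax (K φ (φ ⇒ φ)))) (ax (K φ φ))

  mp₂ : ∀ {φ ψ γ} → Γ ⊢ φ ⇒ ψ ⇒ γ → Γ ⊢ φ → Γ ⊢ ψ → Γ ⊢ γ
  mp₂ f p q = mp (mp f p) q

  ∧-intro : ∀ {φ ψ} → Γ ⊢ φ → Γ ⊢ ψ → Γ ⊢ φ ∧ ψ
  ∧-intro = mp₂ (ax (∧I _ _))

  ∧-elim₁ : ∀ {φ ψ} → Γ ⊢ φ ∧ ψ → Γ ⊢ φ
  ∧-elim₁ = mp (ax (∧E₁ _ _))

  ∧-elim₂ : ∀ {φ ψ} → Γ ⊢ φ ∧ ψ → Γ ⊢ ψ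
  ∧-elim₂ = mp (ax (∧E₂ _ _))

  ⇔-axiom-to : ∀ {φ ψ} → Axiom (φ ⇔ ψ) → Γ ⊢ φ → Γ ⊢ ψ
  ⇔-axiom-to a = mp (∧-elim₁ (ax a))

  ⇔-axiom-from : ∀ {φ ψ} → Axiom (φ ⇔ ψ) → Γ ⊢ ψ → Γ ⊢ φ
  ⇔-axiom-from a = mp (∧-elim₂ (ax a))

  ∼∼-elim : ∀ {φ} → Γ ⊢ ∼ ∼ φ → Γ ⊢ φ
  ∼∼-elim {φ} d = mp₂ (ax (∼ax (∼ φ) φ)) (mp (ax (K _ _)) d) ⊢-id

deduction : ∀ {Γ φ ψ} → Γ ▸ φ ⊢ ψ → Γ ⊢ φ ⇒ ψ
deduction (hyp (inj₁ g))    = mp (ax (K _ _)) (hyp g)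
deduction (hyp (inj₂ refl)) = ⊢-id
deduction (ax a)            = mp (ax (K _ _)) (ax a)
deduction (mp f d)          = mp (mp (ax (S _ _ _)) (deduction f)) (deduction d)

weaken : ∀ {Γ φ ψ} → Γ ⊢ ψ → Γ ▸ φ ⊢ ψ
weaken (hyp g)  = hyp (inj₁ g)
weaken (ax a)   = ax a
weaken (mp f d) = mp (weaken f) (weaken d)

assumption : ∀ {Γ φ} → Γ ▸ φ ⊢ φ
assumption = hyp (inj₂ refl)

∼-intro : ∀ {Γ φ ψ} → Γ ▸ φ ⊢ ψ → Γ ▸ φ ⊢ ∼ ψ → Γ ⊢ ∼ φ
∼-intro {Γ} {φ} {ψ} p ¬p =
  mp₂ (ax (∼ax ψ (∼ φ))) (under-∼∼ (deduction ¬p)) (under-∼∼ (deduction p))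
  where
  under-∼∼ : ∀ {γ} → Γ ⊢ φ ⇒ γ → Γ ⊢ ∼ ∼ φ ⇒ γ
  under-∼∼ f = deduction (mp (weaken f) (∼∼-elim assumption))

module _ {Γ : Form → Set} {φ : Form} where

  □-elim : Γ ⊢ □ φ → Γ ⊢ φ
  □-elim = mp (ax (T φ))

  □⇒∼¬' : Γ ⊢ □ φ → Γ ⊢ ∼ ¬' φ
  □⇒∼¬' d = mp (ax (T _)) (⇔-axiom-to (□∼¬ φ) d)

  □∼⇒¬' : Γ ⊢ □ ∼ φ → Γ ⊢ ¬' φ
  □∼⇒¬' d = mp (ax (T _)) (⇔-axiom-from (□∼¬ (¬' φ)) (⇔-axiom-to (□∼¬¬ φ) d))

module _ {Γ : Form → Set} {φ : Form} where

  ⇒∼□∼ : Γ ⊢ φ → Γ ⊢ ∼ □ ∼ φ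
  ⇒∼□∼ d = ∼-intro (weaken d) (□-elim assumption)

  ∼⇒∼□ : Γ ⊢ ∼ φ → Γ ⊢ ∼ □ φ
  ∼⇒∼□ d = ∼-intro (□-elim assumption) (weaken d)

  ¬'⇒∼□ : Γ ⊢ ¬' φ → Γ ⊢ ∼ □ φ
  ¬'⇒∼□ d = ∼-intro (weaken d) (□⇒∼¬' assumption)

  ∼¬'⇒∼□∼ : Γ ⊢ ∼ ¬' φ → Γ ⊢ ∼ □ ∼ φ
  ∼¬'⇒∼□∼ d = ∼-intro (□∼⇒¬' assumption) (weaken d)

premise : ∀ {φ} → ⟨ φ ⟩ ⊢ φ
premise = hyp refl

module _ (φ : Form) where

  θ-T₀ : □ φ ≣ φ ∧ □ φ ∧ ∼ □ ∼ φ ∧ ∼ ¬' φ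
  θ-T₀ = ∧-intro (□-elim premise)
           (∧-intro premise (∧-intro (⇒∼□∼ (□-elim premise)) (□⇒∼¬' premise)))
       , ∧-elim₁ (∧-elim₂ premise)

  θ-t₁ : φ ∧ ¬' φ ≣ φ ∧ ∼ □ φ ∧ ∼ □ ∼ φ ∧ ¬' φ
  θ-t₁ = ∧-intro p (∧-intro (¬'⇒∼□ ¬p) (∧-intro (⇒∼□∼ p) ¬p))
       , ∧-intro (∧-elim₁ premise) (∧-elim₂ (∧-elim₂ (∧-elim₂ premise)))
    where
    p : ⟨ φ ∧ ¬' φ ⟩ ⊢ φ
    p = ∧-elim₁ premise
    ¬p : ⟨ φ ∧ ¬' φ ⟩ ⊢ ¬' φ
    ¬p = ∧-elim₂ premise

  θ-t₀ : φ ∧ ∼ ¬' φ ∧ ∼ □ φ ≣ φ ∧ ∼ □ φ ∧ ∼ □ ∼ φ ∧ ∼ ¬' φ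
  θ-t₀ = ∧-intro p (∧-intro (∧-elim₂ (∧-elim₂ premise)) (∧-intro (⇒∼□∼ p) ∼¬p))
       , ∧-intro (∧-elim₁ premise)
           (∧-intro (∧-elim₂ (∧-elim₂ (∧-elim₂ premise))) (∧-elim₁ (∧-elim₂ premise)))
    where
    p : ⟨ φ ∧ ∼ ¬' φ ∧ ∼ □ φ ⟩ ⊢ φ
    p = ∧-elim₁ premise
    ∼¬p : ⟨ φ ∧ ∼ ¬' φ ∧ ∼ □ φ ⟩ ⊢ ∼ ¬' φ
    ∼¬p = ∧-elim₁ (∧-elim₂ premise)

  θ-f₁ : ∼ φ ∧ ¬' φ ∧ ∼ □ ∼ φ ≣ ∼ φ ∧ ∼ □ φ ∧ ∼ □ ∼ φ ∧ ¬' φ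
  θ-f₁ = ∧-intro ∼p (∧-intro (∼⇒∼□ ∼p)
           (∧-intro (∧-elim₂ (∧-elim₂ premise)) (∧-elim₁ (∧-elim₂ premise))))
       , ∧-intro (∧-elim₁ premise)
           (∧-intro (∧-elim₂ (∧-elim₂ (∧-elim₂ premise)))
                    (∧-elim₁ (∧-elim₂ (∧-elim₂ premise))))
    where
    ∼p : ⟨ ∼ φ ∧ ¬' φ ∧ ∼ □ ∼ φ ⟩ ⊢ ∼ φ
    ∼p = ∧-elim₁ premise

  θ-f₀ : ∼ φ ∧ ∼ ¬' φ ≣ ∼ φ ∧ ∼ □ φ ∧ ∼ □ ∼ φ ∧ ∼ ¬' φ
  θ-f₀ = ∧-intro ∼p (∧-intro (∼⇒∼□ ∼p) (∧-intro (∼¬'⇒∼□∼ ∼¬p) ∼¬p))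
       , ∧-intro (∧-elim₁ premise) (∧-elim₂ (∧-elim₂ (∧-elim₂ premise)))
    where
    ∼p : ⟨ ∼ φ ∧ ∼ ¬' φ ⟩ ⊢ ∼ φ
    ∼p = ∧-elim₁ premise
    ∼¬p : ⟨ ∼ φ ∧ ∼ ¬' φ ⟩ ⊢ ∼ ¬' φ
    ∼¬p = ∧-elim₂ premise

  θ-F₁ : □ ∼ φ ≣ ∼ φ ∧ ∼ □ φ ∧ □ ∼ φ ∧ ¬' φ
  θ-F₁ = ∧-intro (□-elim premise)
           (∧-intro (∼⇒∼□ (□-elim premise)) (∧-intro premise (□∼⇒¬' premise)))
       , ∧-elim₁ (∧-elim₂ (∧-elim₂ premise))

mainTheorem6 : ∀ (φ : Form) →
      ((□ φ) ≣ (φ ∧ □ φ ∧ ∼ □ ∼ φ ∧ ∼ ¬' φ))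
    × ((φ ∧ ¬' φ) ≣ (φ ∧ ∼ □ φ ∧ ∼ □ ∼ φ ∧ ¬' φ))
    × ((φ ∧ ∼ ¬' φ ∧ ∼ □ φ) ≣ (φ ∧ ∼ □ φ ∧ ∼ □ ∼ φ ∧ ∼ ¬' φ))
    × ((∼ φ ∧ ¬' φ ∧ ∼ □ ∼ φ) ≣ (∼ φ ∧ ∼ □ φ ∧ ∼ □ ∼ φ ∧ ¬' φ))
    × ((∼ φ ∧ ∼ ¬' φ) ≣ (∼ φ ∧ ∼ □ φ ∧ ∼ □ ∼ φ ∧ ∼ ¬' φ))
    × ((□ ∼ φ) ≣ (∼ φ ∧ ∼ □ φ ∧ □ ∼ φ ∧ ¬' φ))
mainTheorem6 φ = θ-T₀ φ , θ-t₁ φ , θ-t₀ φ , θ-f₁ φ , θ-f₀ φ , θ-F₁ φ
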